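{- Let $L$ be a language on a finite alphabet satisfying a symmetric order condition. Then $L$ is rich, i.e. every full return word in $L$ to a palindrome is a palindrome.
   Context: A language is a set of finite words containing the empty word, closed under taking factors and extendable (each $v\in L$ has letters $a,b$ with $av,vb\in L$). A word $v\in L$ is bispecial if at least two letters $x$ have $xv\in L$ and at least two letters $y$ have $vy\in L$. For strict total orders $(<_A,<_D)$ on the alphabet, a bispecial $v$ satisfies the order condition if whenever $xvy,x'vy'\in L$ with letters $x\ne x'$, $y\ne y'$, then $x<_Ax'$ iff $y<_Dy'$; $L$ satisfies the order condition if all its bispecial words (including the empty word) do; the order condition is symmetric if $<_D$ is the reverse of $<_A$. A palindrome is a word equal to its reverse. A full return word to a word $w$ is a word of $L$ that has exactly two occurrences of $w$, one as a prefix and one as a suffix. -}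

module Defs where

open import Level using (0ℓ)
open import Data.Nat using (ℕ; zero; suc; _+_)
open import Data.Fin using (Fin)
open import Data.Fin.Properties using (_≟_)
open import Data.List using (List; []; _∷_; _++_; reverse; [_])
open import Data.Product using (∃; ∃-syntax; _×_; _,_)
open import Relation.Binary.PropositionalEquality using (_≡_)
open import Relation.Binary.Structures using (IsStrictTotalOrder)
open import Relation.Nullary using (¬_; yes; no)
open import Relation.Nullary.Decidable using (⌊_⌋)
open import Data.List.Properties using (≡-dec)
open import Data.Bool using (Bool; true; false)

Word : ℕ → Set
Word k = List (Fin k)

Language : ℕ → Set₁
Language k = Word k → Set

Factor : {k : ℕ} → Word k → Word k → Set
Factor u v = ∃[ p ] ∃[ s ] (v ≡ p ++ u ++ s)

record IsLanguage {k : ℕ} (L : Language k) : Set where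
  field
    hasEmpty   : L []
    factorial  : ∀ {u v} → L v → Factor u v → L u
    extendable : ∀ {v} → L v → ∃[ a ] ∃[ b ] (L (a ∷ v) × L (v ++ [ b ]))

Bispecial : {k : ℕ} → Language k → Word k → Set
Bispecial L v =
  L v ×
  (∃[ x ] ∃[ x' ] (¬ x ≡ x' × L (x ∷ v) × L (x' ∷ v))) ×
  (∃[ y ] ∃[ y' ] (¬ y ≡ y' × L (v ++ [ y ]) × L (v ++ [ y' ])))

OrderConditionAt : {k : ℕ} → Language k →
  (Fin k → Fin k → Set) → (Fin k → Fin k → Set) → Word k → Set
OrderConditionAt L _<A_ _<D_ v =
  ∀ x x' y y' → ¬ x ≡ x' → ¬ y ≡ y' →
  L (x ∷ v ++ [ y ]) → L (x' ∷ v ++ [ y' ]) →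
  ((x <A x' → y <D y') × (y <D y' → x <A x'))

OrderCondition : {k : ℕ} → Language k →
  (Fin k → Fin k → Set) → (Fin k → Fin k → Set) → Set
OrderCondition L _<A_ _<D_ = ∀ v → Bispecial L v → OrderConditionAt L _<A_ _<D_ v

SymmetricOrderCondition : {k : ℕ} → Language k → Set₁
SymmetricOrderCondition {k} L =
  ∃[ _<A_ ] (IsStrictTotalOrder {A = Fin k} _≡_ _<A_ ×
             OrderCondition L _<A_ (λ a b → b <A a))

Palindrome : {k : ℕ} → Word k → Set
Palindrome w = reverse w ≡ w

isPrefix : {k : ℕ} → Word k → Word k → Bool
isPrefix [] _ = true
isPrefix (_ ∷ _) [] = false
isPrefix (a ∷ w) (b ∷ u) with a ≟ b
... | yes _ = isPrefix w u
... | no _  = false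

occurrences : {k : ℕ} → Word k → Word k → ℕ
occurrences w [] with isPrefix w []
... | true  = 1
... | false = 0
occurrences w (a ∷ u) with isPrefix w (a ∷ u)
... | true  = suc (occurrences w u)
... | false = occurrences w u

FullReturnWord : {k : ℕ} → Language k → Word k → Word k → Set
FullReturnWord L w u =
  L u × (∃[ s ] u ≡ w ++ s) × (∃[ p ] u ≡ p ++ w) × occurrences w u ≡ 2

Rich : {k : ℕ} → Language k → Set
Rich L = ∀ w u → L w → Palindrome w → FullReturnWord L w u → Palindrome u

module Submission where

-- Let u = w s = p w be a full return word to the palindrome w, with N = |p| > 0.
-- Then u is a factor of the N-periodic word c extending it, and w occurs in c
-- exactly at the multiples of N.  For a position i let Right i be the word read
-- rightwards from i and Left i the word read leftwards from i - 1.  If Right i,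
-- Right j first differ at d and Left i, Left j at e, the factor
-- Left i e · μ · Right i d of c is a factor of u (otherwise w would occur inside
-- μ, hence at two positions of c differing by i - j), so μ is bispecial and the
-- symmetric order condition says that the lexicographic order of the Right i is
-- the reverse of that of the Left i.  Together with Right i = c i ∷ Right (i + 1)
-- and Left (i + 1) = c i ∷ Left i, this forces, by induction on the length, the
-- N words Right i and the N words Left i to have the same prefixes with the same
-- multiplicities.  Now Left |w| begins with the reverse of u, so some Right i
-- does; as the reverse of u begins with w, i = 0, that is, u is a palindrome.

open import Function using (_∘_)
open import Data.Nat hiding (_≟_; _<ᵇ_; _≡ᵇ_; compare)
open import Data.Nat.Properties hiding (_≟_; <ᵇ⇒<; ≡ᵇ⇒≡)
open import Algebra.Properties.CommutativeSemigroup +-commutativeSemigroup using (interchange; x∙yz≈y∙xz; xy∙z≈xz∙y)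
open import Data.Nat.Solver using (module +-*-Solver)
open import Data.Nat.DivMod using (_%_; _/_; m≡m%n+[m/n]*n; m%n<n; [m+kn]%n≡m%n; m<n⇒m%n≡m; %-remove-+ˡ)
open import Data.Nat.Divisibility using (_∣_; m%n≡0⇒n∣m; n∣m⇒m%n≡0)
open import Data.Fin using (Fin)
open import Data.Fin.Properties using (_≟_)
open import Data.Bool using (Bool; true; false; _∧_; _∨_; not)
open import Data.Bool.Properties using (∧-zeroʳ; ∧-identityʳ; ∧-conicalˡ; ∧-conicalʳ)
open import Data.List using (List; []; _∷_; _++_; [_]; length; reverse; take; drop; applyUpTo)
open import Data.List.Properties
  using (applyUpTo-∷ʳ; length-++; length-drop; length-reverse; take++drop≡id; unfold-reverse; ++-identityʳ)
open import Data.Product using (∃; ∃-syntax; _×_; _,_; proj₁; proj₂)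
open import Data.Sum using (_⊎_; inj₁; inj₂)
open import Data.Empty using (⊥-elim)
open import Relation.Nullary using (¬_; yes; no)
open import Relation.Binary.PropositionalEquality hiding ([_])
open import Relation.Binary.Structures using (IsStrictTotalOrder)
open import Relation.Binary.Definitions using (tri<; tri≈; tri>; DecidableEquality)
open import Defs

-- Counting

sum< : ℕ → (ℕ → ℕ) → ℕ
sum< zero    f = 0
sum< (suc n) f = f 0 + sum< n (f ∘ suc)

sum<-cong : ∀ n {f g : ℕ → ℕ} → (∀ i → i < n → f i ≡ g i) → sum< n f ≡ sum< n g
sum<-cong zero    eq = refl
sum<-cong (suc n) eq = cong₂ _+_ (eq 0 z<s) (sum<-cong n (λ i i<n → eq (suc i) (s<s i<n)))

sum<-zero : ∀ n → sum< n (λ _ → 0) ≡ 0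
sum<-zero zero    = refl
sum<-zero (suc n) = sum<-zero n

sum<-+ : ∀ n (f g : ℕ → ℕ) → sum< n (λ i → f i + g i) ≡ sum< n f + sum< n g
sum<-+ zero    f g = refl
sum<-+ (suc n) f g = begin
  f 0 + g 0 + sum< n (λ i → f (suc i) + g (suc i))   ≡⟨ cong (f 0 + g 0 +_) (sum<-+ n (f ∘ suc) (g ∘ suc)) ⟩
  f 0 + g 0 + (sum< n (f ∘ suc) + sum< n (g ∘ suc))  ≡⟨ interchange (f 0) (g 0) _ _ ⟩
  f 0 + sum< n (f ∘ suc) + (g 0 + sum< n (g ∘ suc))  ∎
  where open ≡-Reasoning

sum<-mono : ∀ n {f g : ℕ → ℕ} → (∀ i → i < n → f i ≤ g i) → sum< n f ≤ sum< n g
sum<-mono zero    le = z≤n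
sum<-mono (suc n) le = +-mono-≤ (le 0 z<s) (sum<-mono n (λ i i<n → le (suc i) (s<s i<n)))

sum<-term : ∀ n (f : ℕ → ℕ) {j} → j < n → f j ≤ sum< n f
sum<-term (suc n) f {zero}  _         = m≤m+n (f 0) _
sum<-term (suc n) f {suc j} (s<s j<n) = ≤-trans (sum<-term n (f ∘ suc) j<n) (m≤n+m _ (f 0))

sum<-two-terms : ∀ n (f : ℕ → ℕ) {i j} → i < j → j < n → f i + f j ≤ sum< n f
sum<-two-terms (suc n) f {zero}  {suc j} _         (s<s j<n) = +-monoʳ-≤ (f 0) (sum<-term n (f ∘ suc) j<n)
sum<-two-terms (suc n) f {suc i} {suc j} (s<s i<j) (s<s j<n) =
  ≤-trans (sum<-two-terms n (f ∘ suc) i<j j<n) (m≤n+m _ (f 0))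

sum<-snoc : ∀ n (f : ℕ → ℕ) → sum< (suc n) f ≡ sum< n f + f n
sum<-snoc zero    f = +-comm (f 0) 0
sum<-snoc (suc n) f = trans (cong (f 0 +_) (sum<-snoc n (f ∘ suc))) (sym (+-assoc (f 0) _ _))

sum<-rotate : ∀ r n (f : ℕ → ℕ) → (∀ i → f (i + n) ≡ f i) → sum< n (λ i → f (i + r)) ≡ sum< n f
sum<-rotate zero    n f per = sum<-cong n (λ i _ → cong f (+-identityʳ i))
sum<-rotate (suc r) n f per = begin
  sum< n (λ i → f (i + suc r))      ≡⟨ sum<-cong n (λ i _ → cong f (+-suc i r)) ⟩
  sum< n (λ i → f (suc i + r))      ≡⟨ +-cancelʳ-≡ _ _ _ rotate-once ⟩
  sum< n (λ i → f (i + r))          ≡⟨ sum<-rotate r n f per ⟩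
  sum< n f                          ∎
  where
  open ≡-Reasoning
  rotate-once : sum< n (λ i → f (suc i + r)) + f r ≡ sum< n (λ i → f (i + r)) + f r
  rotate-once = begin
    sum< n (λ i → f (suc i + r)) + f r  ≡⟨ +-comm _ (f r) ⟩
    sum< (suc n) (λ i → f (i + r))      ≡⟨ sum<-snoc n (λ i → f (i + r)) ⟩
    sum< n (λ i → f (i + r)) + f (n + r) ≡⟨ cong (λ x → sum< n (λ i → f (i + r)) + f x) (+-comm n r) ⟩
    sum< n (λ i → f (i + r)) + f (r + n) ≡⟨ cong (sum< n (λ i → f (i + r)) +_) (per r) ⟩
    sum< n (λ i → f (i + r)) + f r      ∎

bit : Bool → ℕ
bit true  = 1
bit false = 0

count : (ℕ → Bool) → ℕ → ℕ
count p n = sum< n (bit ∘ p)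

count-cong : ∀ n {p q : ℕ → Bool} → (∀ i → i < n → p i ≡ q i) → count p n ≡ count q n
count-cong n eq = sum<-cong n (λ i i<n → cong bit (eq i i<n))

count-none : ∀ n {p : ℕ → Bool} → (∀ i → i < n → p i ≡ false) → count p n ≡ 0
count-none n none = trans (sum<-cong n (λ i i<n → cong bit (none i i<n))) (sum<-zero n)

count-pos⇒witness : ∀ n (p : ℕ → Bool) → 0 < count p n → ∃[ i ] (i < n × p i ≡ true)
count-pos⇒witness (suc n) p pos with p 0 in p0
... | true  = 0 , z<s , p0
... | false with count-pos⇒witness n (p ∘ suc) pos
...   | i , i<n , pi = suc i , s<s i<n , pi

witness⇒count-pos : ∀ n (p : ℕ → Bool) {j} → j < n → p j ≡ true → 0 < count p n
witness⇒count-pos n p j<n pj = subst (λ b → bit b ≤ count p n) pj (sum<-term n (bit ∘ p) j<n)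

bit-∧-≤ : ∀ a b → bit (a ∧ b) ≤ bit a
bit-∧-≤ false b     = z≤n
bit-∧-≤ true  false = z≤n
bit-∧-≤ true  true  = ≤-refl

bit-∧-split : ∀ a b c x → bit a + (bit b + bit c) ≡ 1 → bit x ≡ bit (a ∧ x) + (bit (b ∧ x) + bit (c ∧ x))
bit-∧-split a b c false _   rewrite ∧-zeroʳ a | ∧-zeroʳ b | ∧-zeroʳ c = refl
bit-∧-split a b c true  one rewrite ∧-identityʳ a | ∧-identityʳ b | ∧-identityʳ c = sym one

count-∧-absorb : ∀ n {p q : ℕ → Bool} → (∀ i → i < n → p i ≡ true → q i ≡ true) →
  count (λ i → p i ∧ q i) n ≡ count p n
count-∧-absorb n p⇒q = count-cong n (λ i i<n → absorb (p⇒q i i<n))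
  where
  absorb : ∀ {a b} → (a ≡ true → b ≡ true) → a ∧ b ≡ a
  absorb {false} _ = refl
  absorb {true}  b = b refl

⊓-clamp : ∀ {G S H g s} → G ≤ g → S ≤ s → (0 < H → S ≡ s × G ≡ g) → (0 < S → G ≡ g) →
  S ≡ s ⊓ (G + (S + H) ∸ g)
⊓-clamp {G} {S} {suc H} _ _ full _ with full z<s
... | refl , refl = sym (m≤n⇒m⊓n≡m (≤-trans (m≤m+n S (suc H)) (≤-reflexive (sym (m+n∸m≡n G _)))))
⊓-clamp {G} {suc S} {zero} {g} {s} _ S≤s _ full with full z<s
... | refl = sym (trans (cong (s ⊓_) (trans (m+n∸m≡n G _) (+-identityʳ _))) (m≥n⇒m⊓n≡n S≤s))
⊓-clamp {G} {zero} {zero} {g} {s} G≤g _ _ _ =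
  sym (trans (cong (s ⊓_) (trans (cong (_∸ g) (+-identityʳ G)) (m≤n⇒m∸n≡0 G≤g))) (⊓-zeroʳ s))

module _ (n : ℕ) (_≺_ : ℕ → ℕ → Set) where

  Precedes : (ℕ → Bool) → (ℕ → Bool) → Set
  Precedes p q = ∀ i j → i < n → j < n → p i ≡ true → q j ≡ true → i ≺ j

  DownClosed : (ℕ → Bool) → Set
  DownClosed d = ∀ i j → i < n → j < n → i ≺ j → d j ≡ true → d i ≡ true

  count-block-∩-downset : (g s h d : ℕ → Bool) →
    (∀ i → i < n → bit (g i) + (bit (s i) + bit (h i)) ≡ 1) →
    Precedes g s → Precedes s h → Precedes g h → DownClosed d →
    count (λ i → s i ∧ d i) n ≡ count s n ⊓ (count d n ∸ count g n)
  count-block-∩-downset g s h d partition g≺s s≺h g≺h down =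
    subst (λ D → count (λ i → s i ∧ d i) n ≡ count s n ⊓ (D ∸ count g n)) (sym split)
      (⊓-clamp (∩-≤ g) (∩-≤ s) h-met s-met)
    where
    split : count d n ≡ count (λ i → g i ∧ d i) n + (count (λ i → s i ∧ d i) n + count (λ i → h i ∧ d i) n)
    split = begin
      count d n ≡⟨ sum<-cong n (λ i i<n → bit-∧-split (g i) (s i) (h i) (d i) (partition i i<n)) ⟩
      sum< n (λ i → bit (g i ∧ d i) + (bit (s i ∧ d i) + bit (h i ∧ d i)))
        ≡⟨ sum<-+ n _ _ ⟩
      count (λ i → g i ∧ d i) n + sum< n (λ i → bit (s i ∧ d i) + bit (h i ∧ d i))
        ≡⟨ cong (count (λ i → g i ∧ d i) n +_) (sum<-+ n _ _) ⟩
      count (λ i → g i ∧ d i) n + (count (λ i → s i ∧ d i) n + count (λ i → h i ∧ d i) n) ∎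
      where open ≡-Reasoning
    ∩-≤ : ∀ p → count (λ i → p i ∧ d i) n ≤ count p n
    ∩-≤ p = sum<-mono n (λ i _ → bit-∧-≤ (p i) (d i))
    below-met : ∀ p q → Precedes p q → 0 < count (λ i → q i ∧ d i) n → count (λ i → p i ∧ d i) n ≡ count p n
    below-met p q p≺q pos with count-pos⇒witness n _ pos
    ... | j , j<n , qdj = count-∧-absorb n (λ i i<n pi →
          down i j i<n j<n (p≺q i j i<n j<n pi (∧-conicalˡ _ _ qdj)) (∧-conicalʳ (q j) _ qdj))
    h-met : 0 < count (λ i → h i ∧ d i) n →
      count (λ i → s i ∧ d i) n ≡ count s n × count (λ i → g i ∧ d i) n ≡ count g n
    h-met pos = below-met s h s≺h pos , below-met g h g≺h pos
    s-met : 0 < count (λ i → s i ∧ d i) n → count (λ i → g i ∧ d i) n ≡ count g n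
    s-met = below-met g s g≺s

-- Words as functions of their positions

module _ {A : Set} where

  applyUpTo-cong : ∀ l {f g : ℕ → A} → (∀ t → t < l → f t ≡ g t) → applyUpTo f l ≡ applyUpTo g l
  applyUpTo-cong zero    _     = refl
  applyUpTo-cong (suc l) agree = cong₂ _∷_ (agree 0 z<s) (applyUpTo-cong l (λ t t<l → agree (suc t) (s<s t<l)))

  window : (ℕ → A) → ℕ → ℕ → List A
  window f S l = applyUpTo (λ t → f (S + t)) l

  window-cong : ∀ l {f g : ℕ → A} {S S′} → (∀ t → t < l → f (S + t) ≡ g (S′ + t)) →
    window f S l ≡ window g S′ l
  window-cong l = applyUpTo-cong l

  window-∷-∷ʳ : ∀ (f : ℕ → A) S l → window f S (2 + l) ≡ f S ∷ window f (suc S) l ++ [ f (suc S + l) ]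
  window-∷-∷ʳ f S l = cong₂ _∷_ (cong f (+-identityʳ S)) (begin
    applyUpTo (λ t → f (S + suc t)) (suc l)          ≡⟨ applyUpTo-cong (suc l) (λ t _ → cong f (+-suc S t)) ⟩
    applyUpTo (λ t → f (suc S + t)) (suc l)          ≡⟨ applyUpTo-∷ʳ (λ t → f (suc S + t)) l ⟨
    window f (suc S) l ++ [ f (suc S + l) ]          ∎)
    where open ≡-Reasoning

module _ {A : Set} (default : A) where

  at : List A → ℕ → A
  at []       _       = default
  at (x ∷ xs) zero    = x
  at (x ∷ xs) (suc t) = at xs t

  at-++ˡ : ∀ xs ys {t} → t < length xs → at (xs ++ ys) t ≡ at xs t
  at-++ˡ (x ∷ xs) ys {zero}  _         = refl
  at-++ˡ (x ∷ xs) ys {suc t} (s<s t<n) = at-++ˡ xs ys t<n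

  at-++ʳ : ∀ xs ys t → at (xs ++ ys) (length xs + t) ≡ at ys t
  at-++ʳ []       ys t = refl
  at-++ʳ (x ∷ xs) ys t = at-++ʳ xs ys t

  at-drop : ∀ xs q t → at (drop q xs) t ≡ at xs (q + t)
  at-drop []       zero    t = refl
  at-drop []       (suc q) t = refl
  at-drop (x ∷ xs) zero    t = refl
  at-drop (x ∷ xs) (suc q) t = at-drop xs q t

  at-reverse : ∀ xs {t} → t < length xs → at (reverse xs) t ≡ at xs (length xs ∸ suc t)
  at-reverse (x ∷ xs) {t} t<n rewrite unfold-reverse x xs with m≤n⇒m<n∨m≡n (s≤s⁻¹ t<n)
  ... | inj₁ t<len = begin
    at (reverse xs ++ [ x ]) t          ≡⟨ at-++ˡ (reverse xs) [ x ] (subst (t <_) (sym (length-reverse xs)) t<len) ⟩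
    at (reverse xs) t                   ≡⟨ at-reverse xs t<len ⟩
    at xs (length xs ∸ suc t)           ≡⟨ cong (at (x ∷ xs)) (+-∸-assoc 1 t<len) ⟨
    at (x ∷ xs) (length (x ∷ xs) ∸ suc t) ∎
    where open ≡-Reasoning
  ... | inj₂ refl = begin
    at (reverse xs ++ [ x ]) (length xs)
      ≡⟨ cong (at (reverse xs ++ [ x ])) (trans (+-identityʳ _) (length-reverse xs)) ⟨
    at (reverse xs ++ [ x ]) (length (reverse xs) + 0)
      ≡⟨ at-++ʳ (reverse xs) [ x ] 0 ⟩
    x                                                ≡⟨ cong (at (x ∷ xs)) (n∸n≡0 (length xs)) ⟨
    at (x ∷ xs) (length xs ∸ length xs)              ∎
    where open ≡-Reasoning

  at-extensionality : ∀ xs ys → length xs ≡ length ys → (∀ t → t < length xs → at xs t ≡ at ys t) → xs ≡ ys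
  at-extensionality []       []       _   _     = refl
  at-extensionality (x ∷ xs) (y ∷ ys) len agree =
    cong₂ _∷_ (agree 0 z<s) (at-extensionality xs ys (suc-injective len) (λ t t<n → agree (suc t) (s<s t<n)))

  take-as-applyUpTo : ∀ l xs → l ≤ length xs → take l xs ≡ applyUpTo (at xs) l
  take-as-applyUpTo zero    xs       _         = refl
  take-as-applyUpTo (suc l) (x ∷ xs) (s≤s l≤n) = cong (x ∷_) (take-as-applyUpTo l xs l≤n)

  window-factor : ∀ xs S l → S + l ≤ length xs → ∃[ p ] ∃[ q ] (xs ≡ p ++ window (at xs) S l ++ q)
  window-factor xs S l S+l≤n = take S xs , drop l (drop S xs) , (begin
    xs                                                     ≡⟨ take++drop≡id S xs ⟨
    take S xs ++ drop S xs                                 ≡⟨ cong (take S xs ++_) (take++drop≡id l (drop S xs)) ⟨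
    take S xs ++ take l (drop S xs) ++ drop l (drop S xs)  ≡⟨ cong (λ v → take S xs ++ v ++ drop l (drop S xs)) middle ⟩
    take S xs ++ window (at xs) S l ++ drop l (drop S xs)  ∎)
    where
    open ≡-Reasoning
    l≤ : l ≤ length (drop S xs)
    l≤ = subst (l ≤_) (sym (length-drop S xs)) (subst (_≤ length xs ∸ S) (m+n∸m≡n S l) (∸-monoˡ-≤ S S+l≤n))
    middle : take l (drop S xs) ≡ window (at xs) S l
    middle = trans (take-as-applyUpTo l (drop S xs) l≤) (applyUpTo-cong l (λ t _ → at-drop xs S t))

module _ {k : ℕ} where

  isPrefix-at : ∀ (d : Fin k) w v → length w ≤ length v → (∀ t → t < length w → at d v t ≡ at d w t) →
    isPrefix w v ≡ true
  isPrefix-at d []      v       _         _     = refl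
  isPrefix-at d (a ∷ w) (b ∷ v) (s≤s w≤v) agree with a ≟ b
  ... | yes _   = isPrefix-at d w v w≤v (λ t t<n → agree (suc t) (s<s t<n))
  ... | no  a≢b = ⊥-elim (a≢b (sym (agree 0 z<s)))

  isPrefix-refl : ∀ (w : Word k) → isPrefix w w ≡ true
  isPrefix-refl []      = refl
  isPrefix-refl (a ∷ w) with a ≟ a
  ... | yes _   = isPrefix-refl w
  ... | no  a≢a = ⊥-elim (a≢a refl)

  isPrefix⇒length-≤ : ∀ (w v : Word k) → isPrefix w v ≡ true → length w ≤ length v
  isPrefix⇒length-≤ []      v       _ = z≤n
  isPrefix⇒length-≤ (a ∷ w) (b ∷ v) prefix with a ≟ b
  ... | yes _ = s≤s (isPrefix⇒length-≤ w v prefix)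

  occurrences-as-count : ∀ (w u : Word k) → occurrences w u ≡ count (λ q → isPrefix w (drop q u)) (suc (length u))
  occurrences-as-count w []      with isPrefix w []
  ... | true  = refl
  ... | false = refl
  occurrences-as-count w (a ∷ u) with isPrefix w (a ∷ u)
  ... | true  = cong suc (occurrences-as-count w u)
  ... | false = occurrences-as-count w u

  occurrences-self : ∀ (w : Word k) → occurrences w w ≡ 1
  occurrences-self w = begin
    occurrences w w
      ≡⟨ occurrences-as-count w w ⟩
    bit (isPrefix w w) + count (λ q → isPrefix w (drop (suc q) w)) (length w)
      ≡⟨ cong₂ (λ b c → bit b + c) (isPrefix-refl w) (count-none (length w) proper-suffix) ⟩
    1 ∎
    where
    open ≡-Reasoning
    proper-suffix : ∀ q → q < length w → isPrefix w (drop (suc q) w) ≡ false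
    proper-suffix q q<n with isPrefix w (drop (suc q) w) in prefix
    ... | false = refl
    ... | true  = ⊥-elim (<⇒≱ shorter (isPrefix⇒length-≤ w _ prefix))
      where
      shorter : length (drop (suc q) w) < length w
      shorter = subst (_< length w) (sym (length-drop (suc q) w)) (∸-monoʳ-< z<s q<n)

-- Lexicographic order of infinite words

module _ {A : Set} where

  AgreeBelow : ℕ → (ℕ → A) → (ℕ → A) → Set
  AgreeBelow d f g = ∀ t → t < d → f t ≡ g t

  FirstDifference : (ℕ → A) → (ℕ → A) → ℕ → Set
  FirstDifference f g d = AgreeBelow d f g × f d ≢ g d

  agree-or-first-difference : DecidableEquality A → ∀ l f g → AgreeBelow l f g ⊎ ∃ (FirstDifference f g)
  agree-or-first-difference _≟_ zero    f g = inj₁ (λ _ ())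
  agree-or-first-difference _≟_ (suc l) f g with f 0 ≟ g 0
  ... | no  f0≢g0 = inj₂ (0 , (λ _ ()) , f0≢g0)
  ... | yes f0≡g0 with agree-or-first-difference _≟_ l (f ∘ suc) (g ∘ suc)
  ...   | inj₁ agree            = inj₁ λ { zero _ → f0≡g0 ; (suc t) (s<s t<l) → agree t t<l }
  ...   | inj₂ (d , agree , fd≢gd) = inj₂ (suc d , (λ { zero _ → f0≡g0 ; (suc t) (s<s t<d) → agree t t<d }) , fd≢gd)

  FirstDifference-sym : ∀ {f g d} → FirstDifference f g d → FirstDifference g f d
  FirstDifference-sym (agree , fd≢gd) = (λ t t<d → sym (agree t t<d)) , (λ gd≡fd → fd≢gd (sym gd≡fd))

module Lexicographic {A : Set} {_≺_ : A → A → Set} (sto : IsStrictTotalOrder _≡_ _≺_) where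

  open IsStrictTotalOrder sto using (compare; irrefl; asym) renaming (trans to ≺-trans)

  LexLt : (ℕ → A) → (ℕ → A) → Set
  LexLt f g = ∃[ d ] (AgreeBelow d f g × f d ≺ g d)

  LexLt-head : ∀ {f g} → f 0 ≺ g 0 → LexLt f g
  LexLt-head f0<g0 = 0 , (λ _ ()) , f0<g0

  LexLt-irrefl : ∀ {f} → ¬ LexLt f f
  LexLt-irrefl (_ , _ , fd<fd) = irrefl refl fd<fd

  LexLt-at-first-difference : ∀ {f g d} → FirstDifference f g d → LexLt f g → f d ≺ g d
  LexLt-at-first-difference {d = d} (agree , fd≢gd) (d′ , agree′ , fd′<gd′) with <-cmp d d′
  ... | tri< d<d′ _ _ = ⊥-elim (fd≢gd (agree′ d d<d′))
  ... | tri≈ _ refl _ = fd′<gd′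
  ... | tri> _ _ d′<d = ⊥-elim (irrefl (agree d′ d′<d) fd′<gd′)

  infix 8 _<ᵇ_ _≡ᵇ_ _>ᵇ_

  _<ᵇ_ _≡ᵇ_ _>ᵇ_ : A → A → Bool
  x <ᵇ a with compare x a
  ... | tri< _ _ _ = true
  ... | tri≈ _ _ _ = false
  ... | tri> _ _ _ = false
  x ≡ᵇ a with compare x a
  ... | tri< _ _ _ = false
  ... | tri≈ _ _ _ = true
  ... | tri> _ _ _ = false
  x >ᵇ a with compare x a
  ... | tri< _ _ _ = false
  ... | tri≈ _ _ _ = false
  ... | tri> _ _ _ = true

  <ᵇ⇒< : ∀ x a → x <ᵇ a ≡ true → x ≺ a
  <ᵇ⇒< x a eq with compare x a
  ... | tri< x<a _ _ = x<a

  ≡ᵇ⇒≡ : ∀ x a → x ≡ᵇ a ≡ true → x ≡ a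
  ≡ᵇ⇒≡ x a eq with compare x a
  ... | tri≈ _ x≡a _ = x≡a

  >ᵇ⇒> : ∀ x a → x >ᵇ a ≡ true → a ≺ x
  >ᵇ⇒> x a eq with compare x a
  ... | tri> _ _ a<x = a<x

  trichotomyᵇ : ∀ x a → bit (x >ᵇ a) + (bit (x ≡ᵇ a) + bit (x <ᵇ a)) ≡ 1
  trichotomyᵇ x a with compare x a
  ... | tri< _ _ _ = refl
  ... | tri≈ _ _ _ = refl
  ... | tri> _ _ _ = refl

  lexBelow : (onTie : Bool) → List A → (ℕ → A) → Bool
  lexBelow b []      f = b
  lexBelow b (a ∷ V) f = f 0 <ᵇ a ∨ (f 0 ≡ᵇ a ∧ lexBelow b V (f ∘ suc))

  bit-lexBelow-∷ : ∀ b a V f →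
    bit (lexBelow b (a ∷ V) f) ≡ bit (f 0 <ᵇ a) + bit (f 0 ≡ᵇ a ∧ lexBelow b V (f ∘ suc))
  bit-lexBelow-∷ b a V f with compare (f 0) a
  ... | tri< _ _ _ = refl
  ... | tri≈ _ _ _ = refl
  ... | tri> _ _ _ = refl

  lexBelow-cong : ∀ b V {f g} → (∀ t → f t ≡ g t) → lexBelow b V f ≡ lexBelow b V g
  lexBelow-cong b []      f≗g = refl
  lexBelow-cong b (a ∷ V) f≗g =
    cong₂ (λ x r → x <ᵇ a ∨ (x ≡ᵇ a ∧ r)) (f≗g 0) (lexBelow-cong b V (f≗g ∘ suc))

  private
    false≢true : false ≢ true
    false≢true ()

    ∨-∧-mono : ∀ x y {r r′} → (r ≡ true → r′ ≡ true) → x ∨ (y ∧ r) ≡ true → x ∨ (y ∧ r′) ≡ true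
    ∨-∧-mono true  y     _    _  = refl
    ∨-∧-mono false true  r⇒r′ eq = r⇒r′ eq

  lexBelow-above : ∀ b a V f → a ≺ f 0 → lexBelow b (a ∷ V) f ≡ false
  lexBelow-above b a V f a<f0 with compare (f 0) a
  ... | tri< f0<a _ _ = ⊥-elim (asym a<f0 f0<a)
  ... | tri≈ _ f0≡a _ = ⊥-elim (irrefl (sym f0≡a) a<f0)
  ... | tri> _ _ _    = refl

  lexBelow-downward : ∀ b V {f g} → LexLt g f → lexBelow b V f ≡ true → lexBelow b V g ≡ true
  lexBelow-downward b []      _ below = below
  lexBelow-downward b (a ∷ V) {f} {g} (zero , _ , g0<f0) below with compare (g 0) a
  ... | tri< _ _ _    = refl
  ... | tri≈ _ g0≡a _ = ⊥-elim (false≢true (trans (sym (lexBelow-above b a V f (subst (_≺ f 0) g0≡a g0<f0))) below))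
  ... | tri> _ _ a<g0 = trans (sym (lexBelow-above b a V f (≺-trans a<g0 g0<f0))) below
  lexBelow-downward b (a ∷ V) {f} {g} (suc d , agree , gd<fd) below =
    subst (λ x → x <ᵇ a ∨ (x ≡ᵇ a ∧ lexBelow b V (g ∘ suc)) ≡ true) (sym (agree 0 z<s))
      (∨-∧-mono (f 0 <ᵇ a) (f 0 ≡ᵇ a)
        (lexBelow-downward b V (d , (λ t t<d → agree (suc t) (s<s t<d)) , gd<fd)) below)

  lexBelow-strict⇒weak : ∀ V f → lexBelow false V f ≡ true → lexBelow true V f ≡ true
  lexBelow-strict⇒weak []      f ()
  lexBelow-strict⇒weak (a ∷ V) f = ∨-∧-mono (f 0 <ᵇ a) (f 0 ≡ᵇ a) (lexBelow-strict⇒weak V (f ∘ suc))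

  hasPrefix : List A → (ℕ → A) → Bool
  hasPrefix V f = lexBelow true V f ∧ not (lexBelow false V f)

  bit-lexBelow-true : ∀ V f → bit (lexBelow true V f) ≡ bit (lexBelow false V f) + bit (hasPrefix V f)
  bit-lexBelow-true V f with lexBelow false V f in strict | lexBelow true V f in weak
  ... | false | false = refl
  ... | false | true  = refl
  ... | true  | true  = refl
  ... | true  | false = ⊥-elim (false≢true (trans (sym weak) (lexBelow-strict⇒weak V f strict)))

  lexBelow-applyUpTo : ∀ b l {f g} → AgreeBelow l f g → lexBelow b (applyUpTo g l) f ≡ b
  lexBelow-applyUpTo b zero    _     = refl
  lexBelow-applyUpTo b (suc l) {f} {g} agree =
    subst (λ x → x <ᵇ g 0 ∨ (x ≡ᵇ g 0 ∧ lexBelow b (applyUpTo (g ∘ suc) l) (f ∘ suc)) ≡ b) (sym (agree 0 z<s)) step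
    where
    step : g 0 <ᵇ g 0 ∨ (g 0 ≡ᵇ g 0 ∧ lexBelow b (applyUpTo (g ∘ suc) l) (f ∘ suc)) ≡ b
    step with compare (g 0) (g 0)
    ... | tri< g0<g0 _ _ = ⊥-elim (irrefl refl g0<g0)
    ... | tri≈ _ _ _     = lexBelow-applyUpTo b l (λ t t<l → agree (suc t) (s<s t<l))
    ... | tri> _ _ g0<g0 = ⊥-elim (irrefl refl g0<g0)

  hasPrefix-applyUpTo-self : ∀ l g → hasPrefix (applyUpTo g l) g ≡ true
  hasPrefix-applyUpTo-self l g
    rewrite lexBelow-applyUpTo true l {g} (λ _ _ → refl) | lexBelow-applyUpTo false l {g} (λ _ _ → refl) = refl

  hasPrefix-applyUpTo⇒agree : ∀ l {f g} → hasPrefix (applyUpTo g l) f ≡ true → AgreeBelow l f g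
  hasPrefix-applyUpTo⇒agree (suc l) {f} {g} prefix t t<l with compare (f 0) (g 0)
  hasPrefix-applyUpTo⇒agree (suc l) {f} {g} prefix zero    _         | tri≈ _ f0≡g0 _ = f0≡g0
  hasPrefix-applyUpTo⇒agree (suc l) {f} {g} prefix (suc t) (s<s t<l) | tri≈ _ _ _ =
    hasPrefix-applyUpTo⇒agree l prefix t t<l

module RotationCounting {A : Set} {_≺_ : A → A → Set} (sto : IsStrictTotalOrder _≡_ _≺_)
  (N : ℕ) (X Y : ℕ → ℕ → A) (r : ℕ)
  (X-periodic : ∀ i t → X (i + N) t ≡ X i t)
  (Y-periodic : ∀ i t → Y (i + N) t ≡ Y i t)
  (X-tail : ∀ i t → X i (suc t) ≡ X (i + r) t)
  (X-head : ∀ i → X i 0 ≡ Y (i + r) 0)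
  (reversal : ∀ {i j} → i < N → j < N → Lexicographic.LexLt sto (Y j) (Y i) → Lexicographic.LexLt sto (X i) (X j))
  where

  open IsStrictTotalOrder sto using () renaming (trans to ≺-trans)
  open Lexicographic sto

  head-count : ∀ (F : A → Bool) → count (λ i → F (X i 0)) N ≡ count (λ i → F (Y i 0)) N
  head-count F = trans (count-cong N (λ i _ → cong F (X-head i)))
                       (sum<-rotate r N (λ i → bit (F (Y i 0))) (λ i → cong (bit ∘ F) (Y-periodic i 0)))

  -- By reversal, the indices with Y i 0 ≡ a form a block in the lexicographic
  -- order of the X i, preceded by the indices with Y i 0 > a.
  lexBelow-count-∷ : ∀ b a V → count (lexBelow b (a ∷ V) ∘ X) N ≡
    count (λ i → Y i 0 <ᵇ a) N +
    count (λ i → Y i 0 ≡ᵇ a) N ⊓ (count (lexBelow b V ∘ X) N ∸ count (λ i → Y i 0 >ᵇ a) N)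
  lexBelow-count-∷ b a V = begin
    count (lexBelow b (a ∷ V) ∘ X) N
      ≡⟨ sum<-cong N (λ i _ → bit-lexBelow-∷ b a V (X i)) ⟩
    sum< N (λ i → bit (X i 0 <ᵇ a) + bit (X i 0 ≡ᵇ a ∧ lexBelow b V (X i ∘ suc)))
      ≡⟨ sum<-+ N _ _ ⟩
    count (λ i → X i 0 <ᵇ a) N + count (λ i → X i 0 ≡ᵇ a ∧ lexBelow b V (X i ∘ suc)) N
      ≡⟨ cong₂ _+_ (head-count (_<ᵇ a)) shifted ⟩
    count (λ i → Y i 0 <ᵇ a) N + count (λ i → s i ∧ d i) N
      ≡⟨ cong (count (λ i → Y i 0 <ᵇ a) N +_) clamped ⟩
    count (λ i → Y i 0 <ᵇ a) N + count s N ⊓ (count d N ∸ count g N) ∎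
    where
    open ≡-Reasoning
    g s h d : ℕ → Bool
    g i = Y i 0 >ᵇ a
    s i = Y i 0 ≡ᵇ a
    h i = Y i 0 <ᵇ a
    d i = lexBelow b V (X i)
    shifted : count (λ i → X i 0 ≡ᵇ a ∧ lexBelow b V (X i ∘ suc)) N ≡ count (λ i → s i ∧ d i) N
    shifted = trans
      (count-cong N (λ i _ → cong₂ (λ x z → x ≡ᵇ a ∧ z) (X-head i) (lexBelow-cong b V (X-tail i))))
      (sum<-rotate r N (λ i → bit (s i ∧ d i))
        (λ i → cong bit (cong₂ (λ x z → x ≡ᵇ a ∧ z) (Y-periodic i 0) (lexBelow-cong b V (X-periodic i)))))
    clamped : count (λ i → s i ∧ d i) N ≡ count s N ⊓ (count d N ∸ count g N)
    clamped = count-block-∩-downset N (λ i j → LexLt (X i) (X j)) g s h d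
      (λ i _ → trichotomyᵇ (Y i 0) a)
      (λ i j i<N j<N gi sj → reversal i<N j<N (LexLt-head (subst (_≺ Y i 0) (sym (≡ᵇ⇒≡ _ _ sj)) (>ᵇ⇒> _ _ gi))))
      (λ i j i<N j<N si hj → reversal i<N j<N (LexLt-head (subst (Y j 0 ≺_) (sym (≡ᵇ⇒≡ _ _ si)) (<ᵇ⇒< _ _ hj))))
      (λ i j i<N j<N gi hj → reversal i<N j<N (LexLt-head (≺-trans (<ᵇ⇒< _ _ hj) (>ᵇ⇒> _ _ gi))))
      (λ i j _ _ Xi<Xj dj → lexBelow-downward b V Xi<Xj dj)

module MirrorCounting {A : Set} {_≺_ : A → A → Set} (sto : IsStrictTotalOrder _≡_ _≺_)
  (N : ℕ) (X Y : ℕ → ℕ → A) (r r′ : ℕ)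
  (X-periodic : ∀ i t → X (i + N) t ≡ X i t)
  (Y-periodic : ∀ i t → Y (i + N) t ≡ Y i t)
  (X-tail : ∀ i t → X i (suc t) ≡ X (i + r) t)
  (X-head : ∀ i → X i 0 ≡ Y (i + r) 0)
  (Y-tail : ∀ i t → Y i (suc t) ≡ Y (i + r′) t)
  (Y-head : ∀ i → Y i 0 ≡ X (i + r′) 0)
  (X-reversal : ∀ {i j} → i < N → j < N → Lexicographic.LexLt sto (Y j) (Y i) → Lexicographic.LexLt sto (X i) (X j))
  (Y-reversal : ∀ {i j} → i < N → j < N → Lexicographic.LexLt sto (X j) (X i) → Lexicographic.LexLt sto (Y i) (Y j))
  where

  open Lexicographic sto
  private
    module XY = RotationCounting sto N X Y r  X-periodic Y-periodic X-tail X-head X-reversal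
    module YX = RotationCounting sto N Y X r′ Y-periodic X-periodic Y-tail Y-head Y-reversal

  lexBelow-counts-agree : ∀ b V → count (lexBelow b V ∘ X) N ≡ count (lexBelow b V ∘ Y) N
  lexBelow-counts-agree b []      = refl
  lexBelow-counts-agree b (a ∷ V) = begin
    count (lexBelow b (a ∷ V) ∘ X) N
      ≡⟨ XY.lexBelow-count-∷ b a V ⟩
    #Y (_<ᵇ a) + #Y (_≡ᵇ a) ⊓ (count (lexBelow b V ∘ X) N ∸ #Y (_>ᵇ a))
      ≡⟨ cong₂ (λ x y → x + y ⊓ (count (lexBelow b V ∘ X) N ∸ #Y (_>ᵇ a)))
               (XY.head-count (_<ᵇ a)) (XY.head-count (_≡ᵇ a)) ⟨
    #X (_<ᵇ a) + #X (_≡ᵇ a) ⊓ (count (lexBelow b V ∘ X) N ∸ #Y (_>ᵇ a))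
      ≡⟨ cong₂ (λ x y → #X (_<ᵇ a) + #X (_≡ᵇ a) ⊓ (x ∸ y))
               (lexBelow-counts-agree b V) (YX.head-count (_>ᵇ a)) ⟩
    #X (_<ᵇ a) + #X (_≡ᵇ a) ⊓ (count (lexBelow b V ∘ Y) N ∸ #X (_>ᵇ a))
      ≡⟨ YX.lexBelow-count-∷ b a V ⟨
    count (lexBelow b (a ∷ V) ∘ Y) N ∎
    where
    open ≡-Reasoning
    #X #Y : (A → Bool) → ℕ
    #X F = count (λ i → F (X i 0)) N
    #Y F = count (λ i → F (Y i 0)) N

  hasPrefix-counts-agree : ∀ V → count (hasPrefix V ∘ X) N ≡ count (hasPrefix V ∘ Y) N
  hasPrefix-counts-agree V = +-cancelˡ-≡ (count (lexBelow false V ∘ X) N) _ _ (begin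
    count (lexBelow false V ∘ X) N + count (hasPrefix V ∘ X) N  ≡⟨ weak-count X ⟨
    count (lexBelow true V ∘ X) N                               ≡⟨ lexBelow-counts-agree true V ⟩
    count (lexBelow true V ∘ Y) N                               ≡⟨ weak-count Y ⟩
    count (lexBelow false V ∘ Y) N + count (hasPrefix V ∘ Y) N
      ≡⟨ cong (_+ count (hasPrefix V ∘ Y) N) (lexBelow-counts-agree false V) ⟨
    count (lexBelow false V ∘ X) N + count (hasPrefix V ∘ Y) N  ∎)
    where
    open ≡-Reasoning
    weak-count : ∀ Z → count (lexBelow true V ∘ Z) N ≡ count (lexBelow false V ∘ Z) N + count (hasPrefix V ∘ Z) N
    weak-count Z = trans (sum<-cong N (λ i _ → bit-lexBelow-true V (Z i))) (sum<-+ N _ _)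

-- Full return words

bispecial-middle : ∀ {k} {L : Language k} → IsLanguage L → ∀ {x x′ y y′ v} → x ≢ x′ → y ≢ y′ →
  L (x ∷ v ++ [ y ]) → L (x′ ∷ v ++ [ y′ ]) → Bispecial L v
bispecial-middle isL {x} {x′} {y} {y′} {v} x≢x′ y≢y′ xvy∈L x′vy′∈L =
  factorial xvy∈L ([ x ] , [ y ] , refl) ,
  (x , x′ , x≢x′ , factorial xvy∈L ([] , [ y ] , refl) , factorial x′vy′∈L ([] , [ y′ ] , refl)) ,
  (y , y′ , y≢y′ , factorial xvy∈L ([ x ] , [] , cong (x ∷_) (sym (++-identityʳ _)))
                 , factorial x′vy′∈L ([ x′ ] , [] , cong (x′ ∷_) (sym (++-identityʳ _))))
  where open IsLanguage isL

module FullReturn {k : ℕ} (w : Word k) (s₀ : Fin k) (s₁ p : Word k)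
  (border : w ++ s₀ ∷ s₁ ≡ p ++ w) (twice : occurrences w (w ++ s₀ ∷ s₁) ≡ 2) where

  u : Word k
  u = w ++ s₀ ∷ s₁

  m N₁ N n : ℕ
  m  = length w
  N₁ = length s₁
  N  = suc N₁
  n  = length u

  n≡m+N : n ≡ m + N
  n≡m+N = length-++ w

  n≡N+m : n ≡ N + m
  n≡N+m = trans n≡m+N (+-comm m N)

  m≤n : m ≤ n
  m≤n = subst (m ≤_) (sym n≡m+N) (m≤m+n m N)

  length-p : length p ≡ N
  length-p = +-cancelʳ-≡ _ _ _ (begin
    length p + m   ≡⟨ length-++ p ⟨
    length (p ++ w) ≡⟨ cong length border ⟨
    n              ≡⟨ n≡m+N ⟩
    m + N          ≡⟨ +-comm m N ⟩
    N + m          ∎)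
    where open ≡-Reasoning

  U : ℕ → Fin k
  U = at s₀ u

  U-prefix : ∀ {t} → t < m → U t ≡ at s₀ w t
  U-prefix = at-++ˡ s₀ w (s₀ ∷ s₁)

  U-suffix : ∀ t → U (N + t) ≡ at s₀ w t
  U-suffix t = begin
    at s₀ u (N + t)                  ≡⟨ cong (λ v → at s₀ v (N + t)) border ⟩
    at s₀ (p ++ w) (N + t)           ≡⟨ cong (λ x → at s₀ (p ++ w) (x + t)) length-p ⟨
    at s₀ (p ++ w) (length p + t)    ≡⟨ at-++ʳ s₀ p w t ⟩
    at s₀ w t                        ∎
    where open ≡-Reasoning

  U-periodic : ∀ q r → r + q * N < n → U (r + q * N) ≡ U r
  U-periodic zero    r _  = cong U (+-identityʳ r)
  U-periodic (suc q) r lt = begin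
    U (r + (N + q * N))  ≡⟨ cong U (x∙yz≈y∙xz r N (q * N)) ⟩
    U (N + (r + q * N))  ≡⟨ U-suffix (r + q * N) ⟩
    at s₀ w (r + q * N)  ≡⟨ U-prefix r+qN<m ⟨
    U (r + q * N)        ≡⟨ U-periodic q r (<-≤-trans r+qN<m m≤n) ⟩
    U r                  ∎
    where
    open ≡-Reasoning
    r+qN<m : r + q * N < m
    r+qN<m = +-cancelˡ-< N _ m (subst₂ _<_ (x∙yz≈y∙xz r N (q * N)) n≡N+m lt)

  c : ℕ → Fin k
  c t = U (t % N)

  c-periodic : ∀ x a → c (x + a * N) ≡ c x
  c-periodic x a = cong U ([m+kn]%n≡m%n x a N)

  c-shift : ∀ x → c (x + N) ≡ c x
  c-shift x = trans (cong (λ y → c (x + y)) (sym (*-identityˡ N))) (c-periodic x 1)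

  c-congruent : ∀ {x y} a b → x + a * N ≡ y + b * N → c x ≡ c y
  c-congruent {x} {y} a b eq = trans (sym (c-periodic x a)) (trans (cong c eq) (c-periodic y b))

  c≡U : ∀ {t} → t < n → c t ≡ U t
  c≡U {t} t<n = sym (trans (cong U t≡r+qN) (U-periodic (t / N) (t % N) (subst (_< n) t≡r+qN t<n)))
    where
    t≡r+qN : t ≡ t % N + t / N * N
    t≡r+qN = m≡m%n+[m/n]*n t N

  OccursAt : ℕ → Set
  OccursAt q = ∀ t → t < m → c (q + t) ≡ at s₀ w t

  OccursAt-multiple : ∀ K → OccursAt (K * N)
  OccursAt-multiple K t t<m = begin
    c (K * N + t) ≡⟨ cong c (+-comm (K * N) t) ⟩
    c (t + K * N) ≡⟨ c-periodic t K ⟩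
    c t           ≡⟨ c≡U (≤-trans t<m m≤n) ⟩
    U t           ≡⟨ U-prefix t<m ⟩
    at s₀ w t     ∎
    where open ≡-Reasoning

  occurs-in-u : ∀ q → q + m ≤ n → (∀ t → t < m → U (q + t) ≡ at s₀ w t) → isPrefix w (drop q u) ≡ true
  occurs-in-u q q+m≤n agree = isPrefix-at s₀ w (drop q u)
    (subst (m ≤_) (sym (length-drop q u)) (subst (_≤ n ∸ q) (m+n∸m≡n q m) (∸-monoˡ-≤ q q+m≤n)))
    (λ t t<m → trans (at-drop s₀ u q t) (agree t t<m))

  no-inner-occurrence : ∀ {r} → 0 < r → r < N → ¬ (∀ t → t < m → U (r + t) ≡ at s₀ w t)
  no-inner-occurrence {suc r} _ (s<s r<N₁) agree =
    <⇒≱ three-occurrences (≤-reflexive (trans (sym (occurrences-as-count w u)) twice))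
    where
    P : ℕ → Bool
    P q = isPrefix w (drop q u)
    at-0 : P 0 ≡ true
    at-0 = occurs-in-u 0 m≤n (λ t t<m → U-prefix t<m)
    at-r : P (suc r) ≡ true
    at-r = occurs-in-u (suc r) (subst (suc r + m ≤_) (sym n≡N+m) (+-monoˡ-≤ m (s≤s (<⇒≤ r<N₁)))) agree
    at-N : P N ≡ true
    at-N = occurs-in-u N (≤-reflexive (sym n≡N+m)) (λ t _ → U-suffix t)
    three-occurrences : 3 ≤ count P (suc n)
    three-occurrences = +-mono-≤ (≤-reflexive (sym (cong bit at-0)))
      (subst₂ (λ x y → bit x + bit y ≤ count (P ∘ suc) n) at-r at-N
        (sum<-two-terms n (bit ∘ P ∘ suc) r<N₁ (subst (N₁ <_) (sym n≡N+m) (m≤m+n N m))))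

  OccursAt⇒∣ : ∀ q → OccursAt q → N ∣ q
  OccursAt⇒∣ q at-q with q % N in q%N≡
  ... | zero  = m%n≡0⇒n∣m q N q%N≡
  ... | suc r = ⊥-elim (no-inner-occurrence z<s r<N at-r)
    where
    r<N : suc r < N
    r<N = subst (_< N) q%N≡ (m%n<n q N)
    at-r : ∀ t → t < m → U (suc r + t) ≡ at s₀ w t
    at-r t t<m = begin
      U (suc r + t)               ≡⟨ c≡U (subst (suc r + t <_) (sym n≡N+m) (+-mono-<-≤ r<N (<⇒≤ t<m))) ⟨
      c (suc r + t)               ≡⟨ c-periodic (suc r + t) (q / N) ⟨
      c (suc r + t + q / N * N)   ≡⟨ cong c (xy∙z≈xz∙y (suc r) t (q / N * N)) ⟩
      c (suc r + q / N * N + t)   ≡⟨ cong (λ x → c (x + q / N * N + t)) q%N≡ ⟨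
      c (q % N + q / N * N + t)   ≡⟨ cong (λ x → c (x + t)) (m≡m%n+[m/n]*n q N) ⟨
      c (q + t)                   ≡⟨ at-q t t<m ⟩
      at s₀ w t                   ∎
      where open ≡-Reasoning

  OccursAt-shift : ∀ x {δ} → δ < N → OccursAt x → OccursAt (x + δ) → δ ≡ 0
  OccursAt-shift x {δ} δ<N at-x at-x+δ = begin
    δ             ≡⟨ m<n⇒m%n≡m δ<N ⟨
    δ % N         ≡⟨ %-remove-+ˡ δ (OccursAt⇒∣ x at-x) ⟨
    (x + δ) % N   ≡⟨ n∣m⇒m%n≡0 (x + δ) N (OccursAt⇒∣ (x + δ) at-x+δ) ⟩
    0             ∎
    where open ≡-Reasoning

  OccursAt-unique-≤ : ∀ a {i j} → i ≤ j → j < N → OccursAt (a + i) → OccursAt (a + j) → i ≡ j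
  OccursAt-unique-≤ a {i} {j} i≤j j<N at-i at-j = sym (begin
    j               ≡⟨ m+[n∸m]≡n i≤j ⟨
    i + (j ∸ i)     ≡⟨ cong (i +_) (OccursAt-shift (a + i) j∸i<N at-i (subst OccursAt a+j≡ at-j)) ⟩
    i + 0           ≡⟨ +-identityʳ i ⟩
    i               ∎)
    where
    open ≡-Reasoning
    j∸i<N : j ∸ i < N
    j∸i<N = ≤-<-trans (m∸n≤m j i) j<N
    a+j≡ : a + j ≡ a + i + (j ∸ i)
    a+j≡ = trans (cong (a +_) (sym (m+[n∸m]≡n i≤j))) (sym (+-assoc a i (j ∸ i)))

  OccursAt-unique : ∀ a {i j} → i < N → j < N → OccursAt (a + i) → OccursAt (a + j) → i ≡ j
  OccursAt-unique a i<N j<N at-i at-j with ≤-total _ _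
  ... | inj₁ i≤j = OccursAt-unique-≤ a i≤j j<N at-i at-j
  ... | inj₂ j≤i = sym (OccursAt-unique-≤ a j≤i i<N at-j at-i)

  -- Since N₁ ≡ -1 modulo N, Left i reads c leftwards starting just before position i.
  Right Left : ℕ → ℕ → Fin k
  Right i t = c (i + t)
  Left  i t = c (i + suc t * N₁)

  Left-at : ∀ x i r a → x + suc r ≡ i + a * N → c x ≡ Left i r
  Left-at x i r a x+r+1≡ = c-congruent (suc r) a (begin
    x + suc r * N                  ≡⟨ cong (x +_) (*-suc (suc r) N₁) ⟩
    x + (suc r + suc r * N₁)       ≡⟨ +-assoc x (suc r) _ ⟨
    x + suc r + suc r * N₁         ≡⟨ cong (_+ suc r * N₁) x+r+1≡ ⟩
    i + a * N + suc r * N₁         ≡⟨ xy∙z≈xz∙y i (a * N) _ ⟩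
    i + suc r * N₁ + a * N         ∎)
    where open ≡-Reasoning

  Right-periodic : ∀ i t → Right (i + N) t ≡ Right i t
  Right-periodic i t = trans (cong c (xy∙z≈xz∙y i N t)) (c-shift (i + t))

  Left-periodic : ∀ i t → Left (i + N) t ≡ Left i t
  Left-periodic i t = trans (cong c (xy∙z≈xz∙y i N (suc t * N₁))) (c-shift (i + suc t * N₁))

  Right-tail : ∀ i t → Right i (suc t) ≡ Right (i + 1) t
  Right-tail i t = cong c (sym (+-assoc i 1 t))

  Right-head : ∀ i → Right i 0 ≡ Left (i + 1) 0
  Right-head i = Left-at (i + 0) (i + 1) 0 0 (trans (cong (_+ 1) (+-identityʳ i)) (sym (+-identityʳ (i + 1))))

  Left-tail : ∀ i t → Left i (suc t) ≡ Left (i + N₁) t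
  Left-tail i t = cong c (sym (+-assoc i N₁ (suc t * N₁)))

  Left-head : ∀ i → Left i 0 ≡ Right (i + N₁) 0
  Left-head i = cong c (sym (+-assoc i N₁ 0))

  open +-*-Solver using (solve; _:=_; _:+_; _:*_; con)

  translate-injective : ∀ a {i j} → i < N → j < N → (∀ t → t < n → c (a + i + t) ≡ c (a + j + t)) → i ≡ j
  translate-injective a {i} {j} i<N j<N agree = OccursAt-unique (a + δ) i<N j<N at-i at-j
    where
    r K δ : ℕ
    r = (a + i) % N
    K = (a + i) / N
    δ = N ∸ r
    multiple : a + δ + i ≡ suc K * N
    multiple = begin
      a + δ + i       ≡⟨ xy∙z≈xz∙y a δ i ⟩
      a + i + δ       ≡⟨ cong (_+ δ) (m≡m%n+[m/n]*n (a + i) N) ⟩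
      r + K * N + δ   ≡⟨ solve 3 (λ r KN δ → r :+ KN :+ δ := δ :+ r :+ KN) refl r (K * N) δ ⟩
      δ + r + K * N   ≡⟨ cong (_+ K * N) (m∸n+n≡m (<⇒≤ (m%n<n (a + i) N))) ⟩
      N + K * N       ∎
      where open ≡-Reasoning
    at-i : OccursAt (a + δ + i)
    at-i t t<m = trans (cong (λ x → c (x + t)) multiple) (OccursAt-multiple (suc K) t t<m)
    at-j : OccursAt (a + δ + j)
    at-j t t<m = begin
      c (a + δ + j + t)   ≡⟨ cong c (solve 4 (λ a δ j t → a :+ δ :+ j :+ t := a :+ j :+ (δ :+ t)) refl a δ j t) ⟩
      c (a + j + (δ + t)) ≡⟨ agree (δ + t) (subst (δ + t <_) (sym n≡N+m) (+-mono-≤-< (m∸n≤m N r) t<m)) ⟨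
      c (a + i + (δ + t)) ≡⟨ cong c (solve 4 (λ a δ i t → a :+ i :+ (δ :+ t) := a :+ δ :+ i :+ t) refl a δ i t) ⟩
      c (a + δ + i + t)   ≡⟨ at-i t t<m ⟩
      at s₀ w t           ∎
      where open ≡-Reasoning

  Right-first-difference : ∀ {i j} → i < N → j < N → i ≢ j → ∃ (FirstDifference (Right i) (Right j))
  Right-first-difference {i} {j} i<N j<N i≢j with agree-or-first-difference _≟_ n (Right i) (Right j)
  ... | inj₁ agree = ⊥-elim (i≢j (translate-injective 0 i<N j<N agree))
  ... | inj₂ first = first

  Left-first-difference : ∀ {i j} → i < N → j < N → i ≢ j → ∃ (FirstDifference (Left i) (Left j))
  Left-first-difference {i} {j} i<N j<N i≢j with agree-or-first-difference _≟_ n (Left i) (Left j)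
  ... | inj₁ agree = ⊥-elim (i≢j (translate-injective (n * N₁) i<N j<N agree′))
    where
    mirror : ∀ x {t} → t < n → c (n * N₁ + x + t) ≡ Left x (n ∸ suc t)
    mirror x {t} t<n = Left-at (n * N₁ + x + t) x (n ∸ suc t) n (begin
      n * N₁ + x + t + suc (n ∸ suc t)   ≡⟨ +-assoc (n * N₁ + x) t _ ⟩
      n * N₁ + x + (t + suc (n ∸ suc t)) ≡⟨ cong (n * N₁ + x +_) (trans (+-suc t _) (m+[n∸m]≡n t<n)) ⟩
      n * N₁ + x + n                     ≡⟨ solve 3 (λ y x n → y :+ x :+ n := x :+ (n :+ y)) refl (n * N₁) x n ⟩
      x + (n + n * N₁)                   ≡⟨ cong (x +_) (*-suc n N₁) ⟨
      x + n * N                          ∎)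
      where open ≡-Reasoning
    agree′ : ∀ t → t < n → c (n * N₁ + i + t) ≡ c (n * N₁ + j + t)
    agree′ t t<n = trans (mirror i t<n) (trans (agree _ (∸-monoʳ-< z<s t<n)) (sym (mirror j t<n)))
  ... | inj₂ first = first

  w-at-end : Palindrome w → ∀ {t} → t < m → U (n ∸ suc t) ≡ at s₀ w t
  w-at-end w-palindrome {t} t<m = begin
    U (n ∸ suc t)            ≡⟨ cong (λ x → U (x ∸ suc t)) n≡m+N ⟩
    U (m + N ∸ suc t)        ≡⟨ cong U (trans (+-∸-comm N t<m) (+-comm (m ∸ suc t) N)) ⟩
    U (N + (m ∸ suc t))      ≡⟨ U-suffix (m ∸ suc t) ⟩
    at s₀ w (m ∸ suc t)      ≡⟨ at-reverse s₀ w t<m ⟨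
    at s₀ (reverse w) t      ≡⟨ cong (λ v → at s₀ v t) w-palindrome ⟩
    at s₀ w t                ∎
    where open ≡-Reasoning

  -- A window of c either lies in one copy of u, or it runs past one and then
  -- contains the occurrence of w at the next multiple of N.
  window-factor-or-occurrence : ∀ S l → Factor (window c S (2 + l)) u ⊎ ∃[ o ] (o + m ≤ l × OccursAt (suc S + o))
  window-factor-or-occurrence S l with S % N + (2 + l) ≤? n
  ... | yes fits = inj₁ (subst (λ v → Factor v u) (sym reduced) (window-factor s₀ u o (2 + l) fits))
    where
    o K : ℕ
    o = S % N
    K = S / N
    reduced : window c S (2 + l) ≡ window U o (2 + l)
    reduced = window-cong (2 + l) {c} {U} {S} {o} λ t t<l → begin
      c (S + t)          ≡⟨ cong (λ x → c (x + t)) (m≡m%n+[m/n]*n S N) ⟩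
      c (o + K * N + t)  ≡⟨ cong c (xy∙z≈xz∙y o (K * N) t) ⟩
      c (o + t + K * N)  ≡⟨ c-periodic (o + t) K ⟩
      c (o + t)          ≡⟨ c≡U (<-≤-trans (+-monoʳ-< o t<l) fits) ⟩
      U (o + t)          ∎
      where open ≡-Reasoning
  ... | no overflows = inj₂ (r , r+m≤l , subst OccursAt (sym next-multiple) (OccursAt-multiple (suc K)))
    where
    o K r : ℕ
    o = S % N
    K = S / N
    r = N₁ ∸ o
    o+r≡N₁ : o + r ≡ N₁
    o+r≡N₁ = m+[n∸m]≡n (s≤s⁻¹ (m%n<n S N))
    next-multiple : suc S + r ≡ suc K * N
    next-multiple = begin
      suc S + r            ≡⟨ cong (λ x → suc x + r) (m≡m%n+[m/n]*n S N) ⟩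
      suc (o + K * N) + r  ≡⟨ cong suc (xy∙z≈xz∙y o (K * N) r) ⟩
      suc (o + r + K * N)  ≡⟨ cong (λ x → suc x + K * N) o+r≡N₁ ⟩
      N + K * N            ∎
      where open ≡-Reasoning
    r+m≤l : r + m ≤ l
    r+m≤l = +-cancelˡ-≤ o (r + m) l (s≤s⁻¹ (s≤s⁻¹ (subst₂ _≤_ n+1≡ o+2+l≡ (≰⇒> overflows))))
      where
      n+1≡ : suc n ≡ suc (suc (o + (r + m)))
      n+1≡ = cong suc (trans n≡N+m (cong suc (trans (cong (_+ m) (sym o+r≡N₁)) (+-assoc o r m))))
      o+2+l≡ : o + (2 + l) ≡ suc (suc (o + l))
      o+2+l≡ = trans (+-suc o (suc l)) (cong suc (+-suc o l))

  module UnderOrderCondition (L : Language k) (isL : IsLanguage L) (u∈L : L u)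
    {_<A_ : Fin k → Fin k → Set} (sto : IsStrictTotalOrder _≡_ _<A_)
    (order : OrderCondition L _<A_ (λ a b → b <A a)) where

    open IsLanguage isL using (factorial)
    open Lexicographic sto

    left-part : ∀ x e {t} → t < e → c (suc (x + suc e * N₁) + t) ≡ Left x (e ∸ suc t)
    left-part x e {t} t<e = Left-at (suc (x + X) + t) x (e ∸ suc t) (suc e) (begin
      suc (x + X) + t + suc (e ∸ suc t)    ≡⟨ +-assoc (suc (x + X)) t _ ⟩
      suc (x + X) + (t + suc (e ∸ suc t))  ≡⟨ cong (suc (x + X) +_) (trans (+-suc t _) (m+[n∸m]≡n t<e)) ⟩
      suc (x + X) + e                      ≡⟨ solve 3 (λ x X e → con 1 :+ (x :+ X) :+ e := x :+ (con 1 :+ e :+ X)) refl x X e ⟩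
      x + (suc e + X)                      ≡⟨ cong (x +_) (*-suc (suc e) N₁) ⟨
      x + suc e * N                        ∎)
      where
      open ≡-Reasoning
      X : ℕ
      X = suc e * N₁

    right-part : ∀ x e t → c (suc (x + suc e * N₁) + (e + t)) ≡ Right x t
    right-part x e t = c-congruent 0 (suc e) (begin
      suc (x + X) + (e + t) + 0  ≡⟨ solve 4 (λ x X e t → con 1 :+ (x :+ X) :+ (e :+ t) :+ con 0 := x :+ t :+ (con 1 :+ e :+ X))
                                           refl x X e t ⟩
      x + t + (suc e + X)        ≡⟨ cong (x + t +_) (*-suc (suc e) N₁) ⟨
      x + t + suc e * N          ∎)
      where
      open ≡-Reasoning
      X : ℕ
      X = suc e * N₁

    middle-agree : ∀ x y {e d} → AgreeBelow e (Left x) (Left y) → AgreeBelow d (Right x) (Right y) →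
      ∀ t → t < e + d → c (suc (x + suc e * N₁) + t) ≡ c (suc (y + suc e * N₁) + t)
    middle-agree x y {e} {d} agreeL agreeR t t<e+d with t <? e
    ... | yes t<e = begin
      c (suc (x + suc e * N₁) + t)  ≡⟨ left-part x e t<e ⟩
      Left x (e ∸ suc t)            ≡⟨ agreeL (e ∸ suc t) (∸-monoʳ-< z<s t<e) ⟩
      Left y (e ∸ suc t)            ≡⟨ left-part y e t<e ⟨
      c (suc (y + suc e * N₁) + t)  ∎
      where open ≡-Reasoning
    ... | no  t≮e = begin
      c (suc (x + suc e * N₁) + t)        ≡⟨ cong (λ s → c (suc (x + suc e * N₁) + s)) t≡e+t′ ⟩
      c (suc (x + suc e * N₁) + (e + t′)) ≡⟨ right-part x e t′ ⟩
      Right x t′                          ≡⟨ agreeR t′ (+-cancelˡ-< e t′ d (subst (_< e + d) t≡e+t′ t<e+d)) ⟩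
      Right y t′                          ≡⟨ right-part y e t′ ⟨
      c (suc (y + suc e * N₁) + (e + t′)) ≡⟨ cong (λ s → c (suc (y + suc e * N₁) + s)) t≡e+t′ ⟨
      c (suc (y + suc e * N₁) + t)        ∎
      where
      open ≡-Reasoning
      t′ : ℕ
      t′ = t ∸ e
      t≡e+t′ : t ≡ e + t′
      t≡e+t′ = sym (m+[n∸m]≡n (≮⇒≥ t≮e))

    window-in-L : ∀ {x y e d} → x < N → y < N → x ≢ y →
      AgreeBelow e (Left x) (Left y) → AgreeBelow d (Right x) (Right y) →
      L (Left x e ∷ window c (suc (x + suc e * N₁)) (e + d) ++ [ Right x d ])
    window-in-L {x} {y} {e} {d} x<N y<N x≢y agreeL agreeR = subst L shape window∈L
      where
      X S : ℕ
      X = suc e * N₁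
      S = x + X
      shape : window c S (2 + (e + d)) ≡ Left x e ∷ window c (suc S) (e + d) ++ [ Right x d ]
      shape = trans (window-∷-∷ʳ c S (e + d)) (cong (λ z → Left x e ∷ window c (suc S) (e + d) ++ [ z ]) (right-part x e d))
      window∈L : L (window c S (2 + (e + d)))
      window∈L with window-factor-or-occurrence S (e + d)
      ... | inj₁ factor = factorial u∈L factor
      ... | inj₂ (o , o+m≤e+d , at-o) = ⊥-elim (x≢y (OccursAt-unique (suc X + o) x<N y<N at-x at-y))
        where
        at-x : OccursAt (suc X + o + x)
        at-x t t<m = trans (cong c (solve 4 (λ X o x t → con 1 :+ X :+ o :+ x :+ t := con 1 :+ (x :+ X) :+ o :+ t)
                                              refl X o x t))
                           (at-o t t<m)
        at-y : OccursAt (suc X + o + y)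
        at-y t t<m = begin
          c (suc X + o + y + t)      ≡⟨ cong c (solve 4 (λ X o y t → con 1 :+ X :+ o :+ y :+ t := con 1 :+ (y :+ X) :+ (o :+ t))
                                                        refl X o y t) ⟩
          c (suc (y + X) + (o + t))  ≡⟨ middle-agree x y agreeL agreeR (o + t) (<-≤-trans (+-monoʳ-< o t<m) o+m≤e+d) ⟨
          c (suc S + (o + t))        ≡⟨ cong c (sym (+-assoc (suc S) o t)) ⟩
          c (suc S + o + t)          ≡⟨ at-o t t<m ⟩
          at s₀ w t                  ∎
          where open ≡-Reasoning

    opposite-at-first-differences : ∀ {i j e d} → i < N → j < N →
      FirstDifference (Left i) (Left j) e → FirstDifference (Right i) (Right j) d →
      (Left i e <A Left j e → Right j d <A Right i d) × (Right j d <A Right i d → Left i e <A Left j e)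
    opposite-at-first-differences {i} {j} {e} {d} i<N j<N (agreeL , differL) (agreeR , differR) =
      order μ (bispecial-middle isL differL differR xμy∈L x′μy′∈L) _ _ _ _ differL differR xμy∈L x′μy′∈L
      where
      μ : Word k
      μ = window c (suc (i + suc e * N₁)) (e + d)
      i≢j : i ≢ j
      i≢j refl = differL refl
      xμy∈L : L (Left i e ∷ μ ++ [ Right i d ])
      xμy∈L = window-in-L i<N j<N i≢j agreeL agreeR
      same-middle : window c (suc (j + suc e * N₁)) (e + d) ≡ μ
      same-middle = window-cong (e + d) {c} {c} {suc (j + suc e * N₁)} {suc (i + suc e * N₁)}
        (λ t t<e+d → sym (middle-agree i j agreeL agreeR t t<e+d))
      x′μy′∈L : L (Left j e ∷ μ ++ [ Right j d ])
      x′μy′∈L = subst (λ v → L (Left j e ∷ v ++ [ Right j d ])) same-middle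
        (window-in-L j<N i<N (λ j≡i → i≢j (sym j≡i)) (λ t t<e → sym (agreeL t t<e)) (λ t t<d → sym (agreeR t t<d)))

    Left-reverses-Right : ∀ {i j} → i < N → j < N → LexLt (Left j) (Left i) → LexLt (Right i) (Right j)
    Left-reverses-Right {i} {j} i<N j<N Lj<Li =
      let e , firstL = Left-first-difference j<N i<N j≢i
          d , firstR = Right-first-difference j<N i<N j≢i
      in d , proj₁ (FirstDifference-sym firstR) ,
         proj₁ (opposite-at-first-differences j<N i<N firstL firstR) (LexLt-at-first-difference firstL Lj<Li)
      where
      j≢i : j ≢ i
      j≢i refl = LexLt-irrefl Lj<Li

    Right-reverses-Left : ∀ {i j} → i < N → j < N → LexLt (Right j) (Right i) → LexLt (Left i) (Left j)
    Right-reverses-Left {i} {j} i<N j<N Rj<Ri =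
      let e , firstL = Left-first-difference i<N j<N i≢j
          d , firstR = Right-first-difference i<N j<N i≢j
      in e , proj₁ firstL ,
         proj₂ (opposite-at-first-differences i<N j<N firstL firstR)
               (LexLt-at-first-difference (FirstDifference-sym firstR) Rj<Ri)
      where
      i≢j : i ≢ j
      i≢j refl = LexLt-irrefl Rj<Ri

    open MirrorCounting sto N Right Left 1 N₁ Right-periodic Left-periodic Right-tail Right-head Left-tail Left-head
      Left-reverses-Right Right-reverses-Left using (hasPrefix-counts-agree)

    i₀ : ℕ
    i₀ = m % N

    Left-i₀-reverses-u : ∀ {t} → t < n → Left i₀ t ≡ U (n ∸ suc t)
    Left-i₀-reverses-u {t} t<n = sym (trans (sym (c≡U (∸-monoʳ-< z<s t<n)))
      (Left-at (n ∸ suc t) i₀ t (suc (m / N)) (begin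
        n ∸ suc t + suc t        ≡⟨ m∸n+n≡m t<n ⟩
        n                        ≡⟨ n≡m+N ⟩
        m + N                    ≡⟨ cong (_+ N) (m≡m%n+[m/n]*n m N) ⟩
        i₀ + m / N * N + N       ≡⟨ solve 3 (λ i q N → i :+ q :+ N := i :+ (N :+ q)) refl i₀ (m / N * N) N ⟩
        i₀ + suc (m / N) * N     ∎)))
      where open ≡-Reasoning

    Right-reads-u-backwards : ∃[ i ] (i < N × AgreeBelow n (Right i) (Left i₀))
    Right-reads-u-backwards = agree (count-pos⇒witness N (hasPrefix V ∘ Right) (subst (0 <_) (sym (hasPrefix-counts-agree V)) pos))
      where
      V : Word k
      V = applyUpTo (Left i₀) n
      pos : 0 < count (hasPrefix V ∘ Left) N
      pos = witness⇒count-pos N (hasPrefix V ∘ Left) (m%n<n m N) (hasPrefix-applyUpTo-self n (Left i₀))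
      agree : ∃[ i ] (i < N × hasPrefix V (Right i) ≡ true) → ∃[ i ] (i < N × AgreeBelow n (Right i) (Left i₀))
      agree (i , i<N , prefix) = i , i<N , hasPrefix-applyUpTo⇒agree n prefix

    u-palindrome : Palindrome w → Palindrome u
    u-palindrome w-palindrome = palindrome-from Right-reads-u-backwards
      where
      palindrome-from : ∃[ i ] (i < N × AgreeBelow n (Right i) (Left i₀)) → Palindrome u
      palindrome-from (i , i<N , backwards) = at-extensionality s₀ (reverse u) u (length-reverse u) λ t t<n →
        let t<n′ = subst (t <_) (length-reverse u) t<n in
        trans (at-reverse s₀ u t<n′) (sym (u-symmetric t<n′))
        where
        i≡0 : i ≡ 0
        i≡0 = OccursAt-unique 0 i<N z<s (λ t t<m → trans (backwards t (≤-trans t<m m≤n))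
                                         (trans (Left-i₀-reverses-u (≤-trans t<m m≤n)) (w-at-end w-palindrome t<m)))
                                    (OccursAt-multiple 0)
        u-symmetric : ∀ {t} → t < n → U t ≡ U (n ∸ suc t)
        u-symmetric {t} t<n = begin
          U t              ≡⟨ c≡U t<n ⟨
          Right 0 t        ≡⟨ cong (λ x → Right x t) i≡0 ⟨
          Right i t        ≡⟨ backwards t t<n ⟩
          Left i₀ t        ≡⟨ Left-i₀-reverses-u t<n ⟩
          U (n ∸ suc t)    ∎
          where open ≡-Reasoning

theorem3 : (k : ℕ) (L : Language k) → IsLanguage L →
    SymmetricOrderCondition L → Rich L
theorem3 k L isL (_<A_ , sto , order) w u _ w-palindrome (u∈L , ([] , u≡w) , _ , twice) =
  ⊥-elim (1≢2 (trans (sym (occurrences-self w)) (subst (λ v → occurrences w v ≡ 2) (trans u≡w (++-identityʳ w)) twice)))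
  where
  1≢2 : 1 ≢ 2
  1≢2 ()
theorem3 k L isL (_<A_ , sto , order) w u _ w-palindrome (u∈L , (s₀ ∷ s₁ , u≡ws) , (p , u≡pw) , twice) =
  subst Palindrome (sym u≡ws) (FullReturn.UnderOrderCondition.u-palindrome w s₀ s₁ p (trans (sym u≡ws) u≡pw)
    (subst (λ v → occurrences w v ≡ 2) u≡ws twice) L isL (subst L u≡ws u∈L) sto order w-palindrome)
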